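{- Let $r\ge2$ and $\ell$ be integers with $r+1\le\ell\le2r-1$, and let $m=m_{r,\ell}$. Define $h$ on integers $q\in[0,m]$ by \[h(q)=(q)_{r-1}\cdot\bigl(2r-\ell+2(m-q)(\ell-r)\bigr).\] Then $h(q)<h(m-1)$ for all integers $q\in[0,m]\setminus\{m-1\}$.
   Context: For an integer $j$ and real $z$, $(z)_j=z(z-1)\cdots(z-j+1)$ if $z>j-1$ and $(z)_j=0$ otherwise. $m_{r,\ell}$ is the unique integer $k\ge r$ maximizing $f(k)=\frac{(k-1)_{r-1}}{k^{\ell-1}}$ over integers $k\ge r$. -}

module Defs where

open import Data.Nat using (ℕ; _+_; _*_; _∸_; _^_; _≤_; _<_)
open import Data.Nat.Combinatorics using (_P_)
open import Relation.Binary.PropositionalEquality using (_≡_)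
open import Relation.Nullary using (¬_)
open import Data.Product using (_×_)

-- Falling factorial (z)_j for natural z: z(z-1)...(z-j+1) if z ≥ j, else 0.
-- This is exactly the stdlib's  z P j  (= if j ≤ z then z P′ j else 0).
ff : ℕ → ℕ → ℕ
ff z j = z P j

-- f(k) = (k-1)_{r-1} / k^{ℓ-1}.  For k ≥ r ≥ 1 both numerator and denominator
-- are positive, so  f(j) < f(k)  is expressed by cross-multiplication:
--   (j-1)_{r-1} * k^{ℓ-1} < (k-1)_{r-1} * j^{ℓ-1}.
f-lt : (r ℓ j k : ℕ) → Set
f-lt r ℓ j k = ff (j ∸ 1) (r ∸ 1) * k ^ (ℓ ∸ 1) < ff (k ∸ 1) (r ∸ 1) * j ^ (ℓ ∸ 1)

IsM : (r ℓ m : ℕ) → Set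
IsM r ℓ m = r ≤ m × ((j : ℕ) → r ≤ j → ¬ (j ≡ m) → f-lt r ℓ j m)


-- h(q) = (q)_{r-1} * (2r - ℓ + 2(m-q)(ℓ-r)); all subtractions are
-- non-negative under the hypotheses r+1 ≤ ℓ ≤ 2r-1, q ≤ m.
h : (r ℓ m q : ℕ) → ℕ
h r ℓ m q = ff q (r ∸ 1) * ((2 * r ∸ ℓ) + 2 * (m ∸ q) * (ℓ ∸ r))

{-# OPTIONS --safe #-}
-- Write R = r − 1, c = 2r − ℓ and d = ℓ − r, so that h(q) = (q)_R (c + 2(m − q)d) and c + 2d = ℓ.
-- h vanishes below R, and for R ≤ q < m the ratio h(q+1)/h(q) = (q+1)(c + 2(m−q−1)d) / ((q+1−R)(c + 2(m−q)d))
-- exceeds 1 iff 2d(q+1) < R(c + 2(m−q)d).  Hence h increases on [R, m−1] once 2d(m−1) < R(c + 4d), and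
-- h(m) < h(m−1) iff Rℓ < 2dm.  Both bounds on m come from the maximality of f at m.
-- Unless m = r, f(m−1) < f(m) says (1 − 1/m)^ℓ > 1 − r/m; with (1 − x)^ℓ ≤ 1 − ℓx + C(ℓ,2)x² this gives
-- dm < C(ℓ,2), which implies the first bound because ℓ < 2r.
-- f(m+1) < f(m) says (1 − z)^ℓ < 1 − rz at z = 1/(m+1).  As (1 − (1 − z)^ℓ)/z = ∑_{i<ℓ} (1 − z)ⁱ decreases in z,
-- this cannot happen for z ≥ z₀ = 2d/(Rℓ + 2d), i.e. for m ≤ Rℓ/(2d), provided (1 − z₀)^ℓ ≥ 1 − rz₀; that
-- inequality follows from the degree-5 lower truncation of the binomial series and a polynomial certificate.
module Submission where

open import Defs
open import Data.Bool using (true; false)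
import Data.Bool as Bool
open import Data.Nat
open import Data.Nat.Combinatorics using (_P_; _C_; k>n⇒nPk≡0; nCk+nC[k+1]≡[n+1]C[k+1]; nC1≡n)
open import Data.Nat.Combinatorics.Base using (_P′_)
open import Data.Nat.Properties
open import Data.Nat.Tactic.RingSolver using (solve-∀)
open import Data.Product using (_,_; proj₁)
open import Data.Sum using (inj₁; inj₂)
open import Relation.Binary.PropositionalEquality
open import Relation.Nullary using (¬_; yes; no; contradiction)
import Algebra.Properties.CommutativeSemigroup as CommSemigroupProperties

-- Falling factorials

P≡P′ : ∀ {n k} → k ≤ n → n P k ≡ n P′ k
P≡P′ {n} {k} k≤n with k ≤ᵇ n in eq
... | true  = refl
... | false = contradiction (≤⇒≤ᵇ k≤n) (subst Bool.T eq)

P′-nonZero : ∀ {n} k → k ≤ n → NonZero (n P′ k)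
P′-nonZero zero    _   = _
P′-nonZero (suc k) k<n = m*n≢0 _ _ {{>-nonZero (m<n⇒0<n∸m k<n)}} {{P′-nonZero k (<⇒≤ k<n)}}

P-suc : ∀ n k → n P suc k ≡ (n ∸ k) * (n P′ k)
P-suc n k with ≤-<-connex n k
... | inj₁ n≤k = trans (k>n⇒nPk≡0 (s≤s n≤k)) (cong (_* (n P′ k)) (sym (m≤n⇒m∸n≡0 n≤k)))
... | inj₂ k<n = P≡P′ k<n

suc-P′-suc : ∀ n k → suc n P′ suc k ≡ suc n * (n P′ k)
suc-P′-suc n zero    = refl
suc-P′-suc n (suc k) = begin
  (n ∸ k) * (suc n P′ suc k)    ≡⟨ cong ((n ∸ k) *_) (suc-P′-suc n k) ⟩
  (n ∸ k) * (suc n * (n P′ k))  ≡⟨ x∙yz≈y∙xz (n ∸ k) (suc n) (n P′ k) ⟩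
  suc n * (n P′ suc k)          ∎
  where open ≡-Reasoning; open CommSemigroupProperties *-commutativeSemigroup

suc-P-suc : ∀ {n k} → k ≤ n → suc n P suc k ≡ suc n * (n P′ k)
suc-P-suc {n} {k} k≤n = trans (P≡P′ (s≤s k≤n)) (suc-P′-suc n k)

[1+k+t]∸k≡1+t : ∀ k t → suc (k + t) ∸ k ≡ suc t
[1+k+t]∸k≡1+t k t = trans (+-∸-assoc 1 (m≤m+n k t)) (cong suc (m+n∸m≡n k t))

P-at-offset : ∀ k t → suc (k + t) P suc k ≡ suc t * (suc (k + t) P′ k)
P-at-offset k t = trans (P-suc (suc (k + t)) k) (cong (_* (suc (k + t) P′ k)) ([1+k+t]∸k≡1+t k t))

private
  x*y*z≡y*[x*z] : ∀ x y z → x * y * z ≡ y * (x * z)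
  x*y*z≡y*[x*z] = solve-∀
  ratio-identity : ∀ R t X Y → suc t * (X + Y) + R * (X + Y) ≡ suc (R + t) * X + Y * suc (R + t)
  ratio-identity = solve-∀

*-mono-middle-< : ∀ a b c e F .{{_ : NonZero F}} → a * b < c * e → a * F * b < c * F * e
*-mono-middle-< a b c e F ab<ce = begin-strict
  a * F * b    ≡⟨ x*y*z≡y*[x*z] a F b ⟩
  F * (a * b)  <⟨ *-monoʳ-< F ab<ce ⟩
  F * (c * e)  ≡⟨ x*y*z≡y*[x*z] c F e ⟨
  c * F * e    ∎
  where open ≤-Reasoning

*-cancel-middle-< : ∀ a b c e F → a * F * b < c * F * e → a * b < c * e
*-cancel-middle-< a b c e F aFb<cFe = *-cancelˡ-< F _ _ (subst₂ _<_ (x*y*z≡y*[x*z] a F b) (x*y*z≡y*[x*z] c F e) aFb<cFe)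

ratio-< : ∀ R t X Y → Y * suc (R + t) < R * (X + Y) → suc t * (X + Y) < suc (R + t) * X
ratio-< R t X Y hyp = +-cancelʳ-< (R * (X + Y)) _ _ (begin-strict
  suc t * (X + Y) + R * (X + Y)      ≡⟨ ratio-identity R t X Y ⟩
  suc (R + t) * X + Y * suc (R + t)  <⟨ +-monoʳ-< (suc (R + t) * X) hyp ⟩
  suc (R + t) * X + R * (X + Y)      ∎)
  where open ≤-Reasoning

ratio-> : ∀ R t X Y → R * (X + Y) < Y * suc (R + t) → suc (R + t) * X < suc t * (X + Y)
ratio-> R t X Y hyp = +-cancelʳ-< (Y * suc (R + t)) _ _ (begin-strict
  suc (R + t) * X + Y * suc (R + t)  ≡⟨ ratio-identity R t X Y ⟨
  suc t * (X + Y) + R * (X + Y)      <⟨ +-monoʳ-< (suc t * (X + Y)) hyp ⟩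
  suc t * (X + Y) + Y * suc (R + t)  ∎)
  where open ≤-Reasoning

increasing-chain : ∀ (f : ℕ → ℕ) {a} b → (∀ {q} → a ≤ q → q < b → f q < f (suc q)) →
                   ∀ {q} → a ≤ q → q < b → f q < f b
increasing-chain f (suc b) step {q} a≤q q<1+b with m<1+n⇒m<n∨m≡n q<1+b
... | inj₂ refl = step a≤q q<1+b
... | inj₁ q<b  = <-trans (increasing-chain f b (λ a≤p p<b → step a≤p (m<n⇒m<1+n p<b)) a≤q q<b)
                          (step (≤-trans a≤q (<⇒≤ q<b)) ≤-refl)

-- h with 2r − ℓ, ℓ − r and r − 1 replaced by independent parameters c, d and R
H : (c d R m q : ℕ) → ℕ
H c d R m q = ff q R * (c + 2 * (m ∸ q) * d)

H-step : ∀ {c d R' w q} → let R = suc R' in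
         2 * d * w < R * (c + 4 * d) → R ≤ q → q < w → H c d R (suc w) q < H c d R (suc w) (suc q)
H-step {c} {d} {R'} {q = q} upper R≤q q<w with m≤n⇒∃[o]m+o≡n R≤q | m≤n⇒∃[o]m+o≡n q<w
... | t , refl | s , refl = begin-strict
  ff q R * (c + 2 * (m ∸ q) * d)            ≡⟨ cong₂ (λ a b → a * (c + 2 * b * d)) (P-at-offset R' t) m∸q≡2+s ⟩
  suc t * F * (c + 2 * (2 + s) * d)         ≡⟨ cong (suc t * F *_) (X₂≡X₁+2d c d s) ⟩
  suc t * F * (X₁ + 2 * d)                  <⟨ *-mono-middle-< (suc t) _ (suc q) X₁ F {{F≢0}} (ratio-< R t X₁ (2 * d) step) ⟩
  suc q * F * X₁                            ≡⟨ cong₂ (λ a b → a * (c + 2 * b * d)) (suc-P-suc R'≤q) ([1+k+t]∸k≡1+t q s) ⟨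
  ff (suc q) R * (c + 2 * (m ∸ suc q) * d)  ∎
  where
  open ≤-Reasoning
  R = suc R'
  m = suc (suc q + s)
  F = q P′ R'
  R'≤q : R' ≤ q
  R'≤q = ≤-trans (n≤1+n R') R≤q
  F≢0 : NonZero F
  F≢0 = P′-nonZero R' R'≤q
  X₁ = c + 2 * suc s * d
  X₂≡X₁+2d : ∀ c d s → c + 2 * (2 + s) * d ≡ (c + 2 * suc s * d) + 2 * d
  X₂≡X₁+2d = solve-∀
  X₁+2d≡c+4d+2sd : ∀ c d s → (c + 2 * suc s * d) + 2 * d ≡ c + 4 * d + 2 * s * d
  X₁+2d≡c+4d+2sd = solve-∀
  m∸q≡2+s : m ∸ q ≡ 2 + s
  m∸q≡2+s = trans (+-∸-assoc 2 (m≤m+n q s)) (cong (2 +_) (m+n∸m≡n q s))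
  step : 2 * d * suc q < R * (X₁ + 2 * d)
  step = begin-strict
    2 * d * suc q                ≤⟨ *-monoʳ-≤ (2 * d) (s≤s (m≤m+n q s)) ⟩
    2 * d * (suc q + s)          <⟨ upper ⟩
    R * (c + 4 * d)              ≤⟨ *-monoʳ-≤ R (m≤m+n (c + 4 * d) (2 * s * d)) ⟩
    R * (c + 4 * d + 2 * s * d)  ≡⟨ cong (R *_) (X₁+2d≡c+4d+2sd c d s) ⟨
    R * (X₁ + 2 * d)             ∎

H-last : ∀ {c d R' w} → let R = suc R' in
         R ≤ w → R * (c + 2 * d) < 2 * d * suc w → H c d R (suc w) (suc w) < H c d R (suc w) w
H-last {c} {d} {R'} R≤w lower with m≤n⇒∃[o]m+o≡n R≤w
... | t , refl = begin-strict
  ff m R * (c + 2 * (m ∸ m) * d)  ≡⟨ cong₂ (λ a b → a * (c + 2 * b * d)) (suc-P-suc R'≤w) (n∸n≡0 m) ⟩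
  suc w * F * (c + 0)             ≡⟨ cong (suc w * F *_) (+-identityʳ c) ⟩
  suc w * F * c                   <⟨ *-mono-middle-< (suc w) c (suc t) _ F {{F≢0}} (ratio-> R t c (2 * d) lower) ⟩
  suc t * F * (c + 2 * d)         ≡⟨ cong₂ (λ a b → a * (c + 2 * b * d)) (P-at-offset R' t) m∸w≡1 ⟨
  ff w R * (c + 2 * (m ∸ w) * d)  ∎
  where
  open ≤-Reasoning
  R = suc R'
  w = R + t
  m = suc w
  F = w P′ R'
  R'≤w : R' ≤ w
  R'≤w = ≤-trans (n≤1+n R') R≤w
  F≢0 : NonZero F
  F≢0 = P′-nonZero R' R'≤w
  m∸w≡1 : m ∸ w ≡ 1
  m∸w≡1 = trans (+-∸-assoc 1 (≤-refl {w})) (cong suc (n∸n≡0 w))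

H-max : ∀ {c d R' w} → let R = suc R'; m = suc w in
        R ≤ w → R * (c + 2 * d) < 2 * d * m → 2 * d * w < R * (c + 4 * d) →
        ∀ {q} → q ≤ m → q ≢ w → H c d R m q < H c d R m w
H-max {c} {d} {R'} {w} R≤w lower upper {q} q≤m q≢w with q <? suc R' | m≤n⇒m<n∨m≡n q≤m
... | yes q<R | _         = begin-strict
  ff q R * X       ≡⟨ cong (_* X) (k>n⇒nPk≡0 q<R) ⟩
  0                ≤⟨ z≤n ⟩
  H c d R m m      <⟨ H-last {c} {d} R≤w lower ⟩
  H c d R m w      ∎
  where
  open ≤-Reasoning
  R = suc R'
  m = suc w
  X = c + 2 * (m ∸ q) * d
... | no  q≮R | inj₂ refl = H-last {c} {d} R≤w lower
... | no  q≮R | inj₁ q<m  = increasing-chain (H c d (suc R') (suc w)) w (H-step {c} {d} {R'} upper) (≮⇒≥ q≮R)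
                                             (≤∧≢⇒< (≤-pred q<m) q≢w)

-- Truncated binomial expansions

C-suc : ∀ n k → suc n C suc k ≡ n C k + n C suc k
C-suc n k = sym (nCk+nC[k+1]≡[n+1]C[k+1] n k)

[1+n]C2≡n+nC2 : ∀ n → suc n C 2 ≡ n + n C 2
[1+n]C2≡n+nC2 n = trans (C-suc n 1) (cong (_+ n C 2) (nC1≡n n))

2*[1+n]C2 : ∀ n → 2 * (suc n C 2) ≡ suc n * n
2*[1+n]C2 zero    = refl
2*[1+n]C2 (suc n) = begin
  2 * (suc (suc n) C 2)          ≡⟨ cong (2 *_) ([1+n]C2≡n+nC2 (suc n)) ⟩
  2 * (suc n + suc n C 2)        ≡⟨ *-distribˡ-+ 2 (suc n) (suc n C 2) ⟩
  2 * suc n + 2 * (suc n C 2)    ≡⟨ cong (2 * suc n +_) (2*[1+n]C2 n) ⟩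
  2 * suc n + suc n * n          ≡⟨ collect n ⟩
  suc (suc n) * suc n            ∎
  where
  open ≡-Reasoning
  collect : ∀ n → 2 * suc n + suc n * n ≡ suc (suc n) * suc n
  collect = solve-∀

6*[2+n]C3 : ∀ n → 6 * ((2 + n) C 3) ≡ (2 + n) * (1 + n) * n
6*[2+n]C3 zero    = refl
6*[2+n]C3 (suc n) = begin
  6 * ((3 + n) C 3)                      ≡⟨ cong (6 *_) (C-suc (2 + n) 2) ⟩
  6 * ((2 + n) C 2 + (2 + n) C 3)        ≡⟨ distribute ((2 + n) C 2) ((2 + n) C 3) ⟩
  3 * (2 * ((2 + n) C 2)) + 6 * ((2 + n) C 3)  ≡⟨ cong₂ (λ a b → 3 * a + b) (2*[1+n]C2 (suc n)) (6*[2+n]C3 n) ⟩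
  3 * ((2 + n) * (1 + n)) + (2 + n) * (1 + n) * n  ≡⟨ collect n ⟩
  (3 + n) * (2 + n) * (1 + n)            ∎
  where
  open ≡-Reasoning
  distribute : ∀ a b → 6 * (a + b) ≡ 3 * (2 * a) + 6 * b
  distribute = solve-∀
  collect : ∀ n → 3 * ((2 + n) * (1 + n)) + (2 + n) * (1 + n) * n ≡ (3 + n) * (2 + n) * (1 + n)
  collect = solve-∀

24*[3+n]C4 : ∀ n → 24 * ((3 + n) C 4) ≡ (3 + n) * (2 + n) * (1 + n) * n
24*[3+n]C4 zero    = refl
24*[3+n]C4 (suc n) = begin
  24 * ((4 + n) C 4)                              ≡⟨ cong (24 *_) (C-suc (3 + n) 3) ⟩
  24 * ((3 + n) C 3 + (3 + n) C 4)                ≡⟨ distribute ((3 + n) C 3) ((3 + n) C 4) ⟩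
  4 * (6 * ((3 + n) C 3)) + 24 * ((3 + n) C 4)    ≡⟨ cong₂ (λ a b → 4 * a + b) (6*[2+n]C3 (suc n)) (24*[3+n]C4 n) ⟩
  4 * ((3 + n) * (2 + n) * (1 + n)) + (3 + n) * (2 + n) * (1 + n) * n  ≡⟨ collect n ⟩
  (4 + n) * (3 + n) * (2 + n) * (1 + n)           ∎
  where
  open ≡-Reasoning
  distribute : ∀ a b → 24 * (a + b) ≡ 4 * (6 * a) + 24 * b
  distribute = solve-∀
  collect : ∀ n → 4 * ((3 + n) * (2 + n) * (1 + n)) + (3 + n) * (2 + n) * (1 + n) * n ≡ (4 + n) * (3 + n) * (2 + n) * (1 + n)
  collect = solve-∀

-- 120 C(n+3, 5) = (n+3)(n+2)(n+1) n (n-1), with the subtraction moved to the left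
120*[3+n]C5 : ∀ n → let T = (3 + n) * (2 + n) * (1 + n) * n in 120 * ((3 + n) C 5) + T ≡ T * n
120*[3+n]C5 zero    = refl
120*[3+n]C5 (suc n) = +-cancelʳ-≡ T _ _ (begin
  120 * ((4 + n) C 5) + T′ + T                     ≡⟨ cong (λ x → 120 * x + T′ + T) (C-suc (3 + n) 4) ⟩
  120 * ((3 + n) C 4 + (3 + n) C 5) + T′ + T       ≡⟨ distribute ((3 + n) C 4) ((3 + n) C 5) T T′ ⟩
  5 * (24 * ((3 + n) C 4)) + (120 * ((3 + n) C 5) + T) + T′  ≡⟨ cong₂ (λ a b → 5 * a + b + T′) (24*[3+n]C4 n) (120*[3+n]C5 n) ⟩
  5 * T + T * n + T′                               ≡⟨ collect n ⟩
  T′ * suc n + T                                   ∎)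
  where
  open ≡-Reasoning
  T = (3 + n) * (2 + n) * (1 + n) * n
  T′ = (4 + n) * (3 + n) * (2 + n) * (1 + n)
  distribute : ∀ a b T T′ → 120 * (a + b) + T′ + T ≡ 5 * (24 * a) + (120 * b + T) + T′
  distribute = solve-∀
  collect : ∀ n → let T = (3 + n) * (2 + n) * (1 + n) * n; T′ = (4 + n) * (3 + n) * (2 + n) * (1 + n) in
       5 * T + T * n + T′ ≡ T′ * suc n + T
  collect = solve-∀

-- (1 − x)ⁿ ≤ 1 − n x + C(n,2) x² at x = 1/(w+1), cleared of denominators
binomial-upper₂ : ∀ w n → let u = suc w in w ^ n * u ^ 2 + n * u ^ suc n ≤ u ^ n * (u ^ 2 + n C 2)
binomial-upper₂ w zero    = ≤-reflexive (sym (*-distribˡ-+ 1 (suc w ^ 2) 0))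
binomial-upper₂ w (suc n) = +-cancelʳ-≤ (w * (n * (u * U))) _ _ (begin
  w * X * u ^ 2 + suc n * (u * (u * U)) + w * (n * (u * U))  ≡⟨ regroup w n X U ⟩
  w * (X * u ^ 2 + n * (u * U)) + suc n * (u * (u * U))      ≤⟨ +-monoˡ-≤ _ (*-monoʳ-≤ w (binomial-upper₂ w n)) ⟩
  w * (U * (u ^ 2 + C₂)) + suc n * (u * (u * U))             ≤⟨ m≤m+n _ (C₂ * U) ⟩
  w * (U * (u ^ 2 + C₂)) + suc n * (u * (u * U)) + C₂ * U    ≡⟨ collect w n C₂ U ⟩
  u * U * (u ^ 2 + (n + C₂)) + w * (n * (u * U))            ≡⟨ cong (λ x → u * U * (u ^ 2 + x) + w * (n * (u * U))) ([1+n]C2≡n+nC2 n) ⟨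
  u * U * (u ^ 2 + suc n C 2) + w * (n * (u * U))           ∎)
  where
  open ≤-Reasoning
  u = suc w
  U = u ^ n
  X = w ^ n
  C₂ = n C 2
  regroup : ∀ w n X U → let u = suc w; u² = u * (u * 1) in
            w * X * u² + suc n * (u * (u * U)) + w * (n * (u * U)) ≡ w * (X * u² + n * (u * U)) + suc n * (u * (u * U))
  regroup = solve-∀
  collect : ∀ w n c U → let u = suc w; u² = u * (u * 1) in
            w * (U * (u² + c)) + suc n * (u * (u * U)) + c * U ≡ u * U * (u² + (n + c)) + w * (n * (u * U))
  collect = solve-∀

-- u⁵ ∑_{i ≤ 5} C(n,i) (−v/u)ⁱ = even₅ n u v − odd₅ n u v
even₅ odd₅ : ℕ → ℕ → ℕ → ℕ
even₅ n u v = u ^ 5 + (n C 2) * u ^ 3 * v ^ 2 + (n C 4) * u * v ^ 4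
odd₅  n u v = n * u ^ 4 * v + (n C 3) * u ^ 2 * v ^ 3 + (n C 5) * v ^ 5

-- (1 − z) T(n) = T(n+1) + C(n,5) z⁶ for the degree-5 truncation T(n) of (1 − z)ⁿ, at z = v/u
truncation-step : ∀ w v n → let u = w + v in
  u * even₅ (suc n) u v + w * odd₅ n u v + (n C 5) * v ^ 6 ≡ w * even₅ n u v + u * odd₅ (suc n) u v
truncation-step w v n
  rewrite [1+n]C2≡n+nC2 n | C-suc n 2 | C-suc n 3 | C-suc n 4 = pascal w v n (n C 2) (n C 3) (n C 4) (n C 5)
  where
  pascal : ∀ w v n a₂ a₃ a₄ a₅ →
    let u = w + v; u² = u * (u * 1); u³ = u * u²; u⁴ = u * u³; u⁵ = u * u⁴
        v² = v * (v * 1); v³ = v * v²; v⁴ = v * v³; v⁵ = v * v⁴; v⁶ = v * v⁵ in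
    u * (u⁵ + (n + a₂) * u³ * v² + (a₃ + a₄) * u * v⁴) + w * (n * u⁴ * v + a₃ * u² * v³ + a₅ * v⁵) + a₅ * v⁶
    ≡ w * (u⁵ + a₂ * u³ * v² + a₄ * u * v⁴) + u * (suc n * u⁴ * v + (a₂ + a₃) * u² * v³ + (a₄ + a₅) * v⁵)
  pascal = solve-∀

-- (1 − v/u)ⁿ ≥ ∑_{i ≤ 5} C(n,i) (−v/u)ⁱ, cleared of denominators
binomial-lower₅ : ∀ w v n → let u = w + v in u ^ n * even₅ n u v ≤ w ^ n * u ^ 5 + u ^ n * odd₅ n u v
binomial-lower₅ w v zero    = ≤-reflexive (base ((w + v) ^ 5))
  where
  base : ∀ x → 1 * (x + 0 + 0) ≡ 1 * x + 0
  base = solve-∀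
binomial-lower₅ w v (suc n) = +-cancelʳ-≤ (w * (U * O)) _ _ (begin
  u * U * E′ + w * (U * O)                   ≤⟨ m≤m+n _ (U * ((n C 5) * v ^ 6)) ⟩
  u * U * E′ + w * (U * O) + U * ((n C 5) * v ^ 6)  ≡⟨ factor u U E′ O _ w ⟩
  U * (u * E′ + w * O + (n C 5) * v ^ 6)    ≡⟨ cong (U *_) (truncation-step w v n) ⟩
  U * (w * E + u * O′)                       ≡⟨ expand U w E u O′ ⟩
  w * (U * E) + u * U * O′                   ≤⟨ +-monoˡ-≤ _ (*-monoʳ-≤ w (binomial-lower₅ w v n)) ⟩
  w * (w ^ n * u ^ 5 + U * O) + u * U * O′   ≡⟨ regroup w (w ^ n) (u ^ 5) U O (u * U * O′) ⟩
  w * w ^ n * u ^ 5 + u * U * O′ + w * (U * O)  ∎)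
  where
  open ≤-Reasoning
  u = w + v
  U = u ^ n
  E = even₅ n u v
  O = odd₅ n u v
  E′ = even₅ (suc n) u v
  O′ = odd₅ (suc n) u v
  factor : ∀ u U E′ O X w → u * U * E′ + w * (U * O) + U * X ≡ U * (u * E′ + w * O + X)
  factor = solve-∀
  expand : ∀ U w E u O′ → U * (w * E + u * O′) ≡ w * (U * E) + u * U * O′
  expand = solve-∀
  regroup : ∀ w W u⁵ U O Z → w * (W * u⁵ + U * O) + Z ≡ w * W * u⁵ + Z + w * (U * O)
  regroup = solve-∀

-- Geometric sums

geomSum : ℕ → ℕ → ℕ → ℕ
geomSum u w zero    = 0
geomSum u w (suc n) = w ^ n + u * geomSum u w n

[w+v]^n≡w^n+v*geomSum : ∀ w v n → (w + v) ^ n ≡ w ^ n + v * geomSum (w + v) w n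
[w+v]^n≡w^n+v*geomSum w v zero    = cong suc (sym (*-zeroʳ v))
[w+v]^n≡w^n+v*geomSum w v (suc n) = begin
  (w + v) * (w + v) ^ n                                ≡⟨ cong ((w + v) *_) ([w+v]^n≡w^n+v*geomSum w v n) ⟩
  (w + v) * (w ^ n + v * geomSum (w + v) w n)          ≡⟨ expand w v (w ^ n) (geomSum (w + v) w n) ⟩
  w * w ^ n + v * (w ^ n + (w + v) * geomSum (w + v) w n)  ∎
  where
  open ≡-Reasoning
  expand : ∀ w v a s → (w + v) * (a + v * s) ≡ w * a + v * (a + (w + v) * s)
  expand = solve-∀

[m*n]^k≡m^k*n^k : ∀ m n k → (m * n) ^ k ≡ m ^ k * n ^ k
[m*n]^k≡m^k*n^k m n zero    = refl
[m*n]^k≡m^k*n^k m n (suc k) = trans (cong (m * n *_) ([m*n]^k≡m^k*n^k m n k)) (interchange m n (m ^ k) (n ^ k))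
  where
  interchange : ∀ a b c d → a * b * (c * d) ≡ a * c * (b * d)
  interchange = solve-∀

-- ∑_{i ≤ k} (w/y)ⁱ ≤ ∑_{i ≤ k} (W/B)ⁱ whenever w/y ≤ W/B
geomSum-ratio-mono : ∀ {w y W B} → w * B ≤ W * y → ∀ k → geomSum y w (suc k) * B ^ k ≤ geomSum B W (suc k) * y ^ k
geomSum-ratio-mono {w} {y} {W} {B} wB≤Wy zero =
  ≤-reflexive (trans (cong (λ x → suc x * 1) (*-zeroʳ y)) (cong (λ x → suc x * 1) (sym (*-zeroʳ B))))
geomSum-ratio-mono {w} {y} {W} {B} wB≤Wy (suc k) = begin
  (w ^ suc k + y * s) * (B * B ^ k)             ≡⟨ split (w ^ suc k) B (B ^ k) s y ⟩
  w ^ suc k * B ^ suc k + y * B * (s * B ^ k)   ≡⟨ cong (_+ y * B * (s * B ^ k)) ([m*n]^k≡m^k*n^k w B (suc k)) ⟨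
  (w * B) ^ suc k + y * B * (s * B ^ k)         ≤⟨ +-mono-≤ (^-monoˡ-≤ (suc k) wB≤Wy) (*-monoʳ-≤ (y * B) (geomSum-ratio-mono wB≤Wy k)) ⟩
  (W * y) ^ suc k + y * B * (S * y ^ k)         ≡⟨ cong (_+ y * B * (S * y ^ k)) ([m*n]^k≡m^k*n^k W y (suc k)) ⟩
  W ^ suc k * y ^ suc k + y * B * (S * y ^ k)   ≡⟨ split′ (W ^ suc k) y (y ^ k) S B ⟨
  (W ^ suc k + B * S) * (y * y ^ k)             ∎
  where
  open ≤-Reasoning
  s = geomSum y w (suc k)
  S = geomSum B W (suc k)
  split : ∀ a p pk g q → (a + q * g) * (p * pk) ≡ a * (p * pk) + q * p * (g * pk)
  split = solve-∀
  split′ : ∀ a p pk g q → (a + q * g) * (p * pk) ≡ a * (p * pk) + p * q * (g * pk)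
  split′ = solve-∀

-- Bounds on the maximiser of f

increase⇒upper-bound : ∀ n R t → let w = suc (R + t) in
                       suc t * suc w ^ n < w ^ suc n → suc n * suc w < suc n C 2 + suc R * suc w
increase⇒upper-bound n R t hyp = +-cancelˡ-< (m * m) _ _ (begin-strict
  m * m + suc n * m                  ≡⟨ complete-square R t n ⟩
  suc t * m + suc n * m + suc R * m  <⟨ +-monoˡ-< (suc R * m) (*-cancelˡ-< (m ^ suc n) _ _ scaled) ⟩
  m * m + C₂ + suc R * m             ≡⟨ +-assoc (m * m) C₂ (suc R * m) ⟩
  m * m + (C₂ + suc R * m)           ∎)
  where
  open ≤-Reasoning
  w = suc (R + t)
  m = suc w
  C₂ = suc n C 2
  scaled : m ^ suc n * (suc t * m + suc n * m) < m ^ suc n * (m * m + C₂)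
  scaled = begin-strict
    m ^ suc n * (suc t * m + suc n * m)             ≡⟨ distribute m (m ^ n) (suc t) (suc n) ⟩
    suc t * m ^ n * m ^ 2 + suc n * m ^ suc (suc n)  <⟨ +-monoˡ-< _ (*-monoˡ-< (m ^ 2) hyp) ⟩
    w ^ suc n * m ^ 2 + suc n * m ^ suc (suc n)      ≤⟨ binomial-upper₂ w (suc n) ⟩
    m ^ suc n * (m ^ 2 + C₂)                         ≡⟨ cong (λ x → m ^ suc n * (m * x + C₂)) (*-identityʳ m) ⟩
    m ^ suc n * (m * m + C₂)                         ∎
    where
    distribute : ∀ m M a b → m * M * (a * m + b * m) ≡ a * M * (m * (m * 1)) + b * (m * (m * M))
    distribute = solve-∀
  complete-square : ∀ R t n → let m = suc (suc (R + t)) in m * m + suc n * m ≡ suc t * m + suc n * m + suc R * m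
  complete-square = solve-∀

-- From here on r = 2 + c + d and ℓ = 3 + c + 2d, i.e. 2r − ℓ = c + 1 and ℓ − r = d + 1; this covers
-- exactly the range r + 1 ≤ ℓ ≤ 2r − 1.
data Regime : ℕ → ℕ → Set where
  regime : ∀ c d → Regime (2 + c + d) (3 + c + d + d)

-- The slack s₀ + ⋯ + s₉ has non-negative coefficients; it was found by computer algebra.
certificate-identity : ∀ c d →
  let k = c + d + d; R = suc (c + d); Q = 2 * suc d; B = R * (3 + k) + Q
      B² = B * (B * 1); B³ = B * B²; B⁴ = B * B³; Q² = Q * (Q * 1); Q³ = Q * Q²; Q⁴ = Q * Q³
      T = (3 + k) * (2 + k) * (1 + k) * k
      s₀ = 3000 + 11096 * c + 17360 * c * c + 15080 * c * c * c + 7960 * c * c * c * c + 2584 * c * c * c * c * c + 480 * c * c * c * c * c * c + 40 * c * c * c * c * c * c * c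
      s₁ = 23992 * d + 77824 * d * c + 106120 * d * c * c + 79400 * d * c * c * c + 35440 * d * c * c * c * c + 9416 * d * c * c * c * c * c + 1360 * d * c * c * c * c * c * c + 80 * d * c * c * c * c * c * c * c
      s₂ = 82128 * d * d + 231856 * d * d * c + 271320 * d * d * c * c + 170880 * d * d * c * c * c + 62200 * d * d * c * c * c * c + 12744 * d * d * c * c * c * c * c + 1280 * d * d * c * c * c * c * c * c + 40 * d * d * c * c * c * c * c * c * c
      s₃ = 158192 * d * d * d + 382624 * d * d * d * c + 375160 * d * d * d * c * c + 191880 * d * d * d * c * c * c + 53640 * d * d * d * c * c * c * c + 7576 * d * d * d * c * c * c * c * c + 400 * d * d * d * c * c * c * c * c * c
      s₄ = 188888 * d * d * d * d + 381336 * d * d * d * d * c + 301880 * d * d * d * d * c * c + 118120 * d * d * d * d * c * c * c + 22640 * d * d * d * d * c * c * c * c + 1664 * d * d * d * d * c * c * c * c * c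
      s₅ = 144600 * d * d * d * d * d + 233760 * d * d * d * d * d * c + 140640 * d * d * d * d * d * c * c + 37600 * d * d * d * d * d * c * c * c + 3720 * d * d * d * d * d * c * c * c * c
      s₆ = 70432 * d * d * d * d * d * d + 85280 * d * d * d * d * d * d * c + 34880 * d * d * d * d * d * d * c * c + 4800 * d * d * d * d * d * d * c * c * c
      s₇ = 20608 * d * d * d * d * d * d * d + 16640 * d * d * d * d * d * d * d * c + 3520 * d * d * d * d * d * d * d * c * c
      s₈ = 3072 * d * d * d * d * d * d * d * d + 1280 * d * d * d * d * d * d * d * d * c
      s₉ = 128 * d * d * d * d * d * d * d * d * d in
  120 * suc d * B⁴ + 20 * ((3 + k) * (2 + k) * (1 + k)) * B² * Q² + T * k * Q⁴
    + (s₀ + s₁ + s₂ + s₃ + s₄ + s₅ + s₆ + s₇ + s₈ + s₉)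
  ≡ 60 * ((3 + k) * (2 + k)) * B³ * Q + 5 * T * B * Q³ + T * Q⁴
certificate-identity = solve-∀

truncation-certificate : ∀ c d → let k = c + d + d; ℓ = 3 + k; Q = 2 * suc d; B = suc (c + d) * ℓ + Q in
  suc d * B ^ 4 + (ℓ C 3) * B ^ 2 * Q ^ 2 + (ℓ C 5) * Q ^ 4 ≤ (ℓ C 2) * B ^ 3 * Q + (ℓ C 4) * B * Q ^ 3
truncation-certificate c d = *-cancelˡ-≤ 120 (+-cancelʳ-≤ (T * Q ^ 4) _ _ (begin
  120 * (suc d * B ^ 4 + C₃ * B ^ 2 * Q ^ 2 + C₅ * Q ^ 4) + T * Q ^ 4
    ≡⟨ spread (suc d) B Q C₃ C₅ T ⟩
  120 * suc d * B ^ 4 + 20 * (6 * C₃) * B ^ 2 * Q ^ 2 + (120 * C₅ + T) * Q ^ 4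
    ≡⟨ cong₂ (λ a b → 120 * suc d * B ^ 4 + 20 * a * B ^ 2 * Q ^ 2 + b * Q ^ 4) (6*[2+n]C3 (suc k)) (120*[3+n]C5 k) ⟩
  120 * suc d * B ^ 4 + 20 * ((3 + k) * (2 + k) * (1 + k)) * B ^ 2 * Q ^ 2 + T * k * Q ^ 4
    ≤⟨ ≤-trans (m≤m+n _ _) (≤-reflexive (certificate-identity c d)) ⟩
  60 * ((3 + k) * (2 + k)) * B ^ 3 * Q + 5 * T * B * Q ^ 3 + T * Q ^ 4
    ≡⟨ cong₂ (λ a b → 60 * a * B ^ 3 * Q + 5 * b * B * Q ^ 3 + T * Q ^ 4) (2*[1+n]C2 (2 + k)) (24*[3+n]C4 k) ⟨
  60 * (2 * C₂) * B ^ 3 * Q + 5 * (24 * C₄) * B * Q ^ 3 + T * Q ^ 4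
    ≡⟨ gather B Q C₂ C₄ T ⟩
  120 * (C₂ * B ^ 3 * Q + C₄ * B * Q ^ 3) + T * Q ^ 4  ∎))
  where
  open ≤-Reasoning
  k = c + d + d
  ℓ = 3 + k
  Q = 2 * suc d
  B = suc (c + d) * ℓ + Q
  C₂ = ℓ C 2
  C₃ = ℓ C 3
  C₄ = ℓ C 4
  C₅ = ℓ C 5
  T = (3 + k) * (2 + k) * (1 + k) * k
  spread : ∀ a B Q C₃ C₅ T → let B² = B * (B * 1); B⁴ = B * (B * B²); Q² = Q * (Q * 1); Q⁴ = Q * (Q * Q²) in
    120 * (a * B⁴ + C₃ * B² * Q² + C₅ * Q⁴) + T * Q⁴ ≡ 120 * a * B⁴ + 20 * (6 * C₃) * B² * Q² + (120 * C₅ + T) * Q⁴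
  spread = solve-∀
  gather : ∀ B Q C₂ C₄ T → let B³ = B * (B * (B * 1)); Q³ = Q * (Q * (Q * 1)); Q⁴ = Q * Q³ in
    60 * (2 * C₂) * B³ * Q + 5 * (24 * C₄) * B * Q³ + T * Q⁴ ≡ 120 * (C₂ * B³ * Q + C₄ * B * Q³) + T * Q⁴
  gather = solve-∀

-- Equivalently (1 − z)^ℓ ≥ 1 − (R+1) z at z = Q/B, where Q = 2(d+1), since B^ℓ − W^ℓ = Q · geomSum B W ℓ.
threshold-geomSum-bound : ∀ c d → let R = suc (c + d); ℓ = 3 + c + d + d; W = R * ℓ; B = W + 2 * suc d in
  geomSum B W ℓ ≤ suc R * B ^ (2 + c + d + d)
threshold-geomSum-bound c d = *-cancelˡ-≤ Q {{Q≢0}} (+-cancelˡ-≤ (W ^ ℓ) _ _ (begin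
  W ^ ℓ + Q * geomSum B W ℓ  ≡⟨ [w+v]^n≡w^n+v*geomSum W Q ℓ ⟨
  B ^ ℓ                      ≤⟨ power-bound ⟩
  W ^ ℓ + r * Q * B ^ L      ≡⟨ cong (W ^ ℓ +_) (x*y*z≡y*[x*z] r Q (B ^ L)) ⟩
  W ^ ℓ + Q * (r * B ^ L)    ∎))
  where
  open ≤-Reasoning
  R = suc (c + d)
  r = suc R
  L = 2 + c + d + d
  ℓ = suc L
  Q = 2 * suc d
  W = R * ℓ
  B = W + Q
  Q≢0 : NonZero Q
  Q≢0 = _
  B≢0 : NonZero B
  B≢0 = >-nonZero (≤-trans (s≤s z≤n) (m≤n+m Q W))
  truncation-beats-linear : odd₅ ℓ B Q + B ^ 5 ≤ even₅ ℓ B Q + r * Q * B ^ 4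
  truncation-beats-linear = begin
    odd₅ ℓ B Q + B ^ 5
      ≡⟨ split-odd c d B Q (ℓ C 3) (ℓ C 5) ⟩
    B ^ 5 + r * Q * B ^ 4 + Q * (suc d * B ^ 4 + (ℓ C 3) * B ^ 2 * Q ^ 2 + (ℓ C 5) * Q ^ 4)
      ≤⟨ +-monoʳ-≤ (B ^ 5 + r * Q * B ^ 4) (*-monoʳ-≤ Q (truncation-certificate c d)) ⟩
    B ^ 5 + r * Q * B ^ 4 + Q * ((ℓ C 2) * B ^ 3 * Q + (ℓ C 4) * B * Q ^ 3)
      ≡⟨ split-even c d B Q (ℓ C 2) (ℓ C 4) ⟨
    even₅ ℓ B Q + r * Q * B ^ 4  ∎
    where
    split-odd : ∀ c d B Q a₃ a₅ →
      let ℓ = 3 + c + d + d; r = 2 + c + d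
          B² = B * (B * 1); B⁴ = B * (B * B²); Q² = Q * (Q * 1); Q³ = Q * Q²; Q⁴ = Q * Q³ in
      ℓ * B⁴ * Q + a₃ * B² * Q³ + a₅ * (Q * Q⁴) + B * B⁴ ≡ B * B⁴ + r * Q * B⁴ + Q * (suc d * B⁴ + a₃ * B² * Q² + a₅ * Q⁴)
    split-odd = solve-∀
    split-even : ∀ c d B Q a₂ a₄ →
      let r = 2 + c + d
          B² = B * (B * 1); B³ = B * B²; B⁴ = B * B³; Q² = Q * (Q * 1); Q³ = Q * Q²; Q⁴ = Q * Q³ in
      B * B⁴ + a₂ * B³ * Q² + a₄ * B * Q⁴ + r * Q * B⁴ ≡ B * B⁴ + r * Q * B⁴ + Q * (a₂ * B³ * Q + a₄ * B * Q³)
    split-even = solve-∀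
  power-bound : B ^ ℓ ≤ W ^ ℓ + r * Q * B ^ L
  power-bound = *-cancelʳ-≤ (B ^ ℓ) _ (B ^ 5) {{m^n≢0 B 5 {{B≢0}}}} (+-cancelˡ-≤ (B ^ ℓ * odd₅ ℓ B Q) _ _ (begin
    B ^ ℓ * odd₅ ℓ B Q + B ^ ℓ * B ^ 5                 ≡⟨ *-distribˡ-+ (B ^ ℓ) _ _ ⟨
    B ^ ℓ * (odd₅ ℓ B Q + B ^ 5)                       ≤⟨ *-monoʳ-≤ (B ^ ℓ) truncation-beats-linear ⟩
    B ^ ℓ * (even₅ ℓ B Q + r * Q * B ^ 4)              ≡⟨ *-distribˡ-+ (B ^ ℓ) _ _ ⟩
    B ^ ℓ * even₅ ℓ B Q + B ^ ℓ * (r * Q * B ^ 4)      ≤⟨ +-monoˡ-≤ _ (binomial-lower₅ W Q ℓ) ⟩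
    W ^ ℓ * B ^ 5 + B ^ ℓ * odd₅ ℓ B Q + B ^ ℓ * (r * Q * B ^ 4)  ≡⟨ regroup (W ^ ℓ) (B ^ L) (odd₅ ℓ B Q) B r Q ⟩
    B ^ ℓ * odd₅ ℓ B Q + (W ^ ℓ + r * Q * B ^ L) * B ^ 5  ∎))
    where
    regroup : ∀ A X O B r Q → let B⁴ = B * (B * (B * (B * 1))) in
      A * (B * B⁴) + B * X * O + B * X * (r * Q * B⁴) ≡ B * X * O + (A + r * Q * X) * (B * B⁴)
    regroup = solve-∀

decrease⇒lower-bound : ∀ c d t → let R = suc (c + d); L = 2 + c + d + d; m = suc (R + t) in
  m * m ^ L < suc t * suc m ^ L → R * (suc c + 2 * suc d) < 2 * suc d * m
decrease⇒lower-bound c d t hyp = ≰⇒> (λ Qm≤W → <⇒≱ hyp (bound Qm≤W))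
  where
  R = suc (c + d)
  r = suc R
  L = 2 + c + d + d
  ℓ = suc L
  m = suc (R + t)
  Q = 2 * suc d
  W = R * ℓ
  B = W + Q
  B^L≢0 : NonZero (B ^ L)
  B^L≢0 = m^n≢0 B L {{>-nonZero (≤-trans (s≤s z≤n) (m≤n+m Q W))}}
  telescope : suc m ^ ℓ ≡ m ^ ℓ + geomSum (suc m) m ℓ
  telescope = trans (subst (λ y → y ^ ℓ ≡ m ^ ℓ + 1 * geomSum y m ℓ) (+-comm m 1) ([w+v]^n≡w^n+v*geomSum m 1 ℓ))
                    (cong (m ^ ℓ +_) (*-identityˡ _))
  bound : 2 * suc d * m ≤ R * (suc c + 2 * suc d) → suc t * suc m ^ L ≤ m * m ^ L
  bound Qm≤W = +-cancelʳ-≤ (r * suc m ^ L) _ _ (begin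
    suc t * suc m ^ L + r * suc m ^ L  ≡⟨ sum-of-parts c d t (suc m ^ L) ⟩
    suc m ^ ℓ                          ≡⟨ telescope ⟩
    m ^ ℓ + geomSum (suc m) m ℓ        ≤⟨ +-monoʳ-≤ (m ^ ℓ) geomSum-bound ⟩
    m ^ ℓ + r * suc m ^ L              ∎)
    where
    open ≤-Reasoning
    sum-of-parts : ∀ c d t Y → suc t * Y + suc (suc (c + d)) * Y ≡ suc (suc (suc (c + d) + t)) * Y
    sum-of-parts = solve-∀
    ℓ≡c′+2d′ : ∀ c d → suc c + 2 * suc d ≡ 3 + c + d + d
    ℓ≡c′+2d′ = solve-∀
    x*y*z≡x*z*y : ∀ x y z → x * y * z ≡ x * z * y
    x*y*z≡x*z*y = solve-∀
    ratio : m * B ≤ W * suc m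
    ratio = begin
      m * (W + Q)   ≡⟨ *-distribˡ-+ m W Q ⟩
      m * W + m * Q ≡⟨ cong₂ _+_ (*-comm m W) (*-comm m Q) ⟩
      W * m + Q * m ≤⟨ +-monoʳ-≤ (W * m) (≤-trans Qm≤W (≤-reflexive (cong (R *_) (ℓ≡c′+2d′ c d)))) ⟩
      W * m + W     ≡⟨ trans (+-comm (W * m) W) (sym (*-suc W m)) ⟩
      W * suc m     ∎
    geomSum-bound : geomSum (suc m) m ℓ ≤ r * suc m ^ L
    geomSum-bound = *-cancelʳ-≤ _ _ (B ^ L) {{B^L≢0}} (begin
      geomSum (suc m) m ℓ * B ^ L  ≤⟨ geomSum-ratio-mono ratio L ⟩
      geomSum B W ℓ * suc m ^ L    ≤⟨ *-monoˡ-≤ (suc m ^ L) (threshold-geomSum-bound c d) ⟩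
      r * B ^ L * suc m ^ L        ≡⟨ x*y*z≡x*z*y r (B ^ L) (suc m ^ L) ⟩
      r * suc m ^ L * B ^ L        ∎)

f-lt-next : ∀ R' L t → let m = suc (suc (R' + t)) in
            f-lt (suc (suc R')) (suc L) (suc m) m → m * m ^ L < suc t * suc m ^ L
f-lt-next R' L t f[m+1]<f[m] = *-cancel-middle-< m (m ^ L) (suc t) (suc m ^ L) (q P′ R')
  (subst₂ (λ a b → a * m ^ L < b * suc m ^ L) (suc-P-suc R'≤q) (P-at-offset R' t) f[m+1]<f[m])
  where
  q = suc (R' + t)
  m = suc q
  R'≤q : R' ≤ q
  R'≤q = ≤-trans (m≤m+n R' t) (n≤1+n _)

f-lt-prev : ∀ R' L t → let w = suc (suc (R' + t)) in
            f-lt (suc (suc R')) (suc L) w (suc w) → suc t * suc w ^ L < w * w ^ L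
f-lt-prev R' L t f[w]<f[w+1] = *-cancel-middle-< (suc t) (suc w ^ L) w (w ^ L) (q P′ R')
  (subst₂ (λ a b → a * suc w ^ L < b * w ^ L) (P-at-offset R' t) (suc-P-suc R'≤q) f[w]<f[w+1])
  where
  q = suc (R' + t)
  w = suc q
  R'≤q : R' ≤ q
  R'≤q = ≤-trans (m≤m+n R' t) (n≤1+n _)

ℓ≤2r∸1⇒2+δ≤r : ∀ {r} δ → 2 ≤ r → r + 1 + δ ≤ 2 * r ∸ 1 → 2 + δ ≤ r
ℓ≤2r∸1⇒2+δ≤r {r} δ 2≤r ℓ≤2r∸1 = +-cancelˡ-≤ r _ _ (subst₂ _≤_ (regroup r δ) (cong (r +_) (+-identityʳ r))
                                                          (m≤o∸n⇒m+n≤o (r + 1 + δ) 1≤2r ℓ≤2r∸1))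
  where
  1≤2r : 1 ≤ 2 * r
  1≤2r = ≤-trans (s≤s z≤n) (≤-trans 2≤r (m≤m+n r (r + 0)))
  regroup : ∀ r δ → r + 1 + δ + 1 ≡ r + (2 + δ)
  regroup = solve-∀

regime? : ∀ {r ℓ} → 2 ≤ r → r + 1 ≤ ℓ → ℓ ≤ 2 * r ∸ 1 → Regime r ℓ
regime? 2≤r r+1≤ℓ ℓ≤2r∸1 with m≤n⇒∃[o]m+o≡n r+1≤ℓ
... | δ , refl with m≤n⇒∃[o]m+o≡n (ℓ≤2r∸1⇒2+δ≤r δ 2≤r ℓ≤2r∸1)
...   | c , refl = subst₂ Regime (r≡ c δ) (ℓ≡ c δ) (regime c δ)
  where
  r≡ : ∀ c δ → 2 + c + δ ≡ 2 + δ + c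
  r≡ = solve-∀
  ℓ≡ : ∀ c δ → 3 + c + δ + δ ≡ 2 + δ + c + 1 + δ
  ℓ≡ = solve-∀

upper-bound-in-regime : ∀ c d w → let ℓ = 3 + c + d + d in
  ℓ * suc w < ℓ C 2 + (2 + c + d) * suc w → 2 * suc d * w < suc (c + d) * (suc c + 4 * suc d)
upper-bound-in-regime c d w hyp = +-cancelʳ-< (2 * suc d) _ _ (begin-strict
  2 * suc d * w + 2 * suc d     ≡⟨ distribute d w ⟩
  2 * (suc d * suc w)           <⟨ *-monoʳ-< 2 d′m<C₂ ⟩
  2 * (ℓ C 2)                   ≡⟨ 2*[1+n]C2 (2 + c + d + d) ⟩
  ℓ * (2 + c + d + d)           ≤⟨ m≤m+n _ (suc c * suc d) ⟩
  ℓ * (2 + c + d + d) + suc c * suc d             ≡⟨ collect c d ⟩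
  suc (c + d) * (suc c + 4 * suc d) + 2 * suc d   ∎)
  where
  open ≤-Reasoning
  ℓ = 3 + c + d + d
  r = 2 + c + d
  r+d′≡ℓ : ∀ c d m → (2 + c + d) * m + suc d * m ≡ (3 + c + d + d) * m
  r+d′≡ℓ = solve-∀
  d′m<C₂ : suc d * suc w < ℓ C 2
  d′m<C₂ = +-cancelˡ-< (r * suc w) _ _ (begin-strict
    r * suc w + suc d * suc w  ≡⟨ r+d′≡ℓ c d (suc w) ⟩
    ℓ * suc w                  <⟨ hyp ⟩
    ℓ C 2 + r * suc w          ≡⟨ +-comm (ℓ C 2) (r * suc w) ⟩
    r * suc w + ℓ C 2          ∎)
  distribute : ∀ d w → 2 * suc d * w + 2 * suc d ≡ 2 * (suc d * suc w)
  distribute = solve-∀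
  collect : ∀ c d → (3 + c + d + d) * (2 + c + d + d) + suc c * suc d ≡ suc (c + d) * (suc c + 4 * suc d) + 2 * suc d
  collect = solve-∀

maximiser-lower-bound : ∀ c d w → IsM (2 + c + d) (3 + c + d + d) (suc w) → suc (c + d) ≤ w →
                        suc (c + d) * (suc c + 2 * suc d) < 2 * suc d * suc w
maximiser-lower-bound c d w (r≤m , maximal) R≤w with m≤n⇒∃[o]m+o≡n R≤w
... | t , refl = decrease⇒lower-bound c d t
                   (f-lt-next (c + d) (2 + c + d + d) t (maximal _ (≤-trans r≤m (n≤1+n _)) 1+n≢n))

maximiser-upper-bound : ∀ c d w → IsM (2 + c + d) (3 + c + d + d) (suc w) → suc (c + d) ≤ w →
                        2 * suc d * w < suc (c + d) * (suc c + 4 * suc d)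
maximiser-upper-bound c d w (_ , maximal) R≤w with m≤n⇒m<n∨m≡n R≤w
... | inj₂ refl = subst (2 * suc d * w <_) (sym (split-off c d)) (m<m+n (2 * suc d * w) z<s)
  where
  split-off : ∀ c d → suc (c + d) * (suc c + 4 * suc d) ≡ 2 * suc d * suc (c + d) + suc (c + d) * (suc c + 2 * suc d)
  split-off = solve-∀
... | inj₁ (s≤s R≤w′) with m≤n⇒∃[o]m+o≡n R≤w′
...   | t , refl = upper-bound-in-regime c d w
                     (increase⇒upper-bound L (suc (c + d)) t
                       (f-lt-prev (c + d) L t (maximal w (s≤s (s≤s (m≤m+n (c + d) t))) (λ eq → 1+n≢n (sym eq)))))
  where L = 2 + c + d + d

m≡n+o⇒m∸n≡o : ∀ {m} n o → m ≡ n + o → m ∸ n ≡ o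
m≡n+o⇒m∸n≡o n o refl = m+n∸m≡n n o

h≡H : ∀ c d m q → h (2 + c + d) (3 + c + d + d) m q ≡ H (suc c) (suc d) (suc (c + d)) m q
h≡H c d m q = cong₂ (λ a b → ff q (suc (c + d)) * (a + 2 * (m ∸ q) * b))
                    (m≡n+o⇒m∸n≡o (3 + c + d + d) (suc c) (2r≡ℓ+c′ c d)) (m≡n+o⇒m∸n≡o (2 + c + d) (suc d) (ℓ≡r+d′ c d))
  where
  2r≡ℓ+c′ : ∀ c d → 2 * (2 + c + d) ≡ (3 + c + d + d) + suc c
  2r≡ℓ+c′ = solve-∀
  ℓ≡r+d′ : ∀ c d → 3 + c + d + d ≡ (2 + c + d) + suc d
  ℓ≡r+d′ = solve-∀

lemma4p3 : (r ℓ m : ℕ) → 2 ≤ r → r + 1 ≤ ℓ → ℓ ≤ 2 * r ∸ 1 → IsM r ℓ m →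
    (q : ℕ) → q ≤ m → ¬ (q ≡ m ∸ 1) → h r ℓ m q < h r ℓ m (m ∸ 1)
lemma4p3 r ℓ m 2≤r r+1≤ℓ ℓ≤2r∸1 isM q q≤m q≢m∸1 with regime? 2≤r r+1≤ℓ ℓ≤2r∸1 | proj₁ isM
... | regime c d | s≤s {n = w} R≤w = subst₂ _<_ (sym (h≡H c d (suc w) q)) (sym (h≡H c d (suc w) w))
  (H-max R≤w (maximiser-lower-bound c d w isM R≤w) (maximiser-upper-bound c d w isM R≤w) q≤m q≢m∸1)
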